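{- Let $t \ge r \ge 1$ and $n \ge 1$ be integers, and let $G$ be a finite $n$-dimensional grid graph (the Cartesian product of $n$ finite paths) with vertex set $V$. Then $$\gamma_{t,r}(G) \geq \frac{r|V|}{C_{t, r}(\mathbb{Z}^n)}.$$
   Context: For a graph $G=(V,E)$ and $D \subseteq V$, the reception at $v$ is $\sum_{u \in D,\ \mathrm{dist}(u,v)\le t}(t-\mathrm{dist}(u,v))$; $D$ is $(t,r)$ broadcast dominating if every vertex has reception at least $r$, and $\gamma_{t,r}(G)$ is the minimum size of such a $D$. In the infinite grid $\mathbb{Z}^n$ (distance $\sum_i|x_i-y_i|$), the unwasted reception a broadcast at $u$ gives to $v$ is $\min(\max(t-\mathrm{dist}(u,v),0), r)$, and $C_{t,r}(\mathbb{Z}^n)$ is the sum over all $v \in \mathbb{Z}^n$ of the unwasted reception given by a broadcast at the origin; equivalently $C_{t,r}(\mathbb{Z}^n) = \sum_{d=t-r+1}^{t-1}(t-d)|S_n(d)| + r\sum_{d=1}^{t-r}|S_n(d)| + r$, where $S_n(d)$ is the set of points of $\mathbb{Z}^n$ at distance exactly $d$ from the origin. -}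

module Defs where

open import Data.Nat using (ℕ; zero; suc; _+_; _*_; _∸_; _≤_; _⊔_; _⊓_; ∣_-_∣)
open import Data.Fin using (Fin; zero; suc; toℕ)
open import Data.Nat.ListAction using (sum)
open import Data.List using (List; []; _∷_; map; length; concatMap; filter; allFin; upTo)
open import Data.Vec using (Vec; []; _∷_)
open import Data.Integer as ℤ using (ℤ; +_; -[1+_])
open import Data.Bool using (Bool; true; false; T)
open import Relation.Nullary.Decidable using (Dec)

-- Finite n-dimensional grid graph P_{m 0} □ ... □ P_{m (n-1)}.
-- A vertex picks a coordinate in Fin (m i) for every i : Fin n.

Vertex : (n : ℕ) → (Fin n → ℕ) → Set
Vertex n m = (i : Fin n) → Fin (m i)

consV : ∀ {n} {m : Fin (suc n) → ℕ} → Fin (m zero) →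
        Vertex n (λ i → m (suc i)) → Vertex (suc n) m
consV a v zero    = a
consV a v (suc i) = v i

allVertices : (n : ℕ) (m : Fin n → ℕ) → List (Vertex n m)
allVertices zero    m = (λ ()) ∷ []
allVertices (suc n) m =
  concatMap (λ a → map (consV a) (allVertices n (λ i → m (suc i)))) (allFin (m zero))

sumFin : (n : ℕ) → (Fin n → ℕ) → ℕ
sumFin n f = sum (map f (allFin n))

-- graph distance in the grid graph (= L1 distance of coordinates)
gridDist : ∀ {n m} → Vertex n m → Vertex n m → ℕ
gridDist {n} u v = sumFin n (λ i → ∣ toℕ (u i) - toℕ (v i) ∣)

card : ∀ {n m} → (Vertex n m → Bool) → ℕ
card {n} {m} D = length (filter (λ u → Data.Bool._≟_ (D u) true) (allVertices n m))

-- reception at v: Σ_{u ∈ D, dist(u,v) ≤ t} (t - dist(u,v))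
-- (t ∸ d is 0 when d ≥ t, so summing t ∸ d over all of D is the same)
reception : ∀ {n m} → ℕ → (Vertex n m → Bool) → Vertex n m → ℕ
reception {n} {m} t D v =
  sum (map (λ u → t ∸ gridDist u v)
           (filter (λ u → Data.Bool._≟_ (D u) true) (allVertices n m)))

IsBroadcastDominating : ∀ {n m} → ℕ → ℕ → (Vertex n m → Bool) → Set
IsBroadcastDominating {n} {m} t r D = (v : Vertex n m) → r ≤ reception t D v

-- C_{t,r}(ℤ^n): total unwasted reception min(max(t - |v|,0), r) of a
-- broadcast at the origin, summed over v ∈ ℤ^n.  Only points with
-- |v|₁ < t contribute, all of which lie in the box [-t,t]^n, so the sum
-- is taken over that box.

intRange : ℕ → List ℤ
intRange t = map (λ k → (+ k) ℤ.- (+ t)) (upTo (suc (t + t)))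

boxPoints : (n : ℕ) → ℕ → List (Vec ℤ n)
boxPoints zero    t = [] ∷ []
boxPoints (suc n) t = concatMap (λ a → map (a ∷_) (boxPoints n t)) (intRange t)

normℤ : ∀ {n} → Vec ℤ n → ℕ
normℤ []       = 0
normℤ (x ∷ xs) = ℤ.∣ x ∣ + normℤ xs

C : (t r n : ℕ) → ℕ
C t r n = sum (map (λ v → (t ∸ normℤ v) ⊓ r) (boxPoints n t))

-- Double counting.  Capping each contribution at r loses nothing at a dominated
-- vertex, so r |V| ≤ Σ_v Σ_{u ∈ D} min(t ∸ d(u,v), r) = Σ_{u ∈ D} Σ_v min(t ∸ d(u,v), r).
-- The displacement v ↦ v - u embeds the grid injectively into ℤ^n, so each inner sum
-- is at most the total unwasted reception C t r n of a broadcast at the origin.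
-- Coordinatewise this is the one-dimensional fact that a translated window of
-- integers meets (-t, t) in at most the points of the box range [-t, t].
module Submission where

open import Defs
open import Data.Nat using (ℕ; zero; suc; _+_; _*_; _∸_; _⊓_; ∣_-_∣; _≤_; _≤?_; z≤n)
open import Data.Nat.Properties
open import Algebra.Properties.CommutativeSemigroup +-commutativeSemigroup using (interchange)
open import Data.Nat.ListAction using (sum)
open import Data.Nat.ListAction.Properties using (sum-++)
open import Data.Fin using (Fin; toℕ)
import Data.Fin as Fin
open import Data.Bool as Bool using (Bool; true)
open import Data.List
  using (List; []; _∷_; map; length; concatMap; filter; tabulate; applyUpTo; upTo; allFin; _++_)
open import Data.List.Properties using (map-++; map-∘; map-cong; map-tabulate; map-upTo)
open import Data.Vec using (Vec; []; _∷_)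
open import Data.Integer as ℤ using (ℤ; +_)
import Data.Integer.Properties as ℤ
open import Data.Integer.Tactic.RingSolver using (solve-∀)
open import Data.Sum using (inj₁; inj₂)
open import Function using (_∘_; id)
open import Relation.Binary.PropositionalEquality
open import Relation.Nullary using (yes; no)

private variable
  A B X : Set

sum-map-mono-≤ : (xs : List A) {f g : A → ℕ} → (∀ x → f x ≤ g x) →
                 sum (map f xs) ≤ sum (map g xs)
sum-map-mono-≤ []       f≤g = z≤n
sum-map-mono-≤ (x ∷ xs) f≤g = +-mono-≤ (f≤g x) (sum-map-mono-≤ xs f≤g)

sum-map-const : (xs : List A) (c : ℕ) → sum (map (λ _ → c) xs) ≡ length xs * c
sum-map-const []       c = refl
sum-map-const (x ∷ xs) c = cong (_+_ c) (sum-map-const xs c)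

sum-map-zero : (xs : List A) {f : A → ℕ} → (∀ x → f x ≡ 0) → sum (map f xs) ≡ 0
sum-map-zero []       f≡0 = refl
sum-map-zero (x ∷ xs) f≡0 = cong₂ _+_ (f≡0 x) (sum-map-zero xs f≡0)

sum-map-+ : (xs : List A) (f g : A → ℕ) →
            sum (map (λ x → f x + g x) xs) ≡ sum (map f xs) + sum (map g xs)
sum-map-+ []       f g = refl
sum-map-+ (x ∷ xs) f g =
  trans (cong (_+_ (f x + g x)) (sum-map-+ xs f g))
        (interchange (f x) (g x) (sum (map f xs)) (sum (map g xs)))

sum-map-concatMap-map : (xs : List A) (ys : List B) (g : A → B → X) (f : X → ℕ) →
  sum (map f (concatMap (λ x → map (g x) ys) xs)) ≡ sum (map (λ x → sum (map (f ∘ g x) ys)) xs)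
sum-map-concatMap-map []       ys g f = refl
sum-map-concatMap-map (x ∷ xs) ys g f = begin
  sum (map f (map (g x) ys ++ concatMap (λ x → map (g x) ys) xs))
    ≡⟨ cong sum (map-++ f (map (g x) ys) _) ⟩
  sum (map f (map (g x) ys) ++ map f (concatMap (λ x → map (g x) ys) xs))
    ≡⟨ sum-++ (map f (map (g x) ys)) _ ⟩
  sum (map f (map (g x) ys)) + sum (map f (concatMap (λ x → map (g x) ys) xs))
    ≡⟨ cong₂ _+_ (sym (cong sum (map-∘ ys))) (sum-map-concatMap-map xs ys g f) ⟩
  sum (map (f ∘ g x) ys) + sum (map (λ x → sum (map (f ∘ g x) ys)) xs) ∎
  where open ≡-Reasoning

sum-map-swap : (xs : List A) (ys : List B) (K : A → B → ℕ) →
  sum (map (λ x → sum (map (K x) ys)) xs) ≡ sum (map (λ y → sum (map (λ x → K x y) xs)) ys)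
sum-map-swap []       ys K = sym (sum-map-zero ys (λ _ → refl))
sum-map-swap (x ∷ xs) ys K =
  trans (cong (_+_ (sum (map (K x) ys))) (sum-map-swap xs ys K))
        (sym (sum-map-+ ys (K x) (λ y → sum (map (λ x → K x y) xs))))

[m+n]⊓o≤m⊓o+n⊓o : ∀ m n o → (m + n) ⊓ o ≤ m ⊓ o + n ⊓ o
[m+n]⊓o≤m⊓o+n⊓o m n o with ≤-total o m
... | inj₁ o≤m = begin
  (m + n) ⊓ o    ≤⟨ m⊓n≤n (m + n) o ⟩
  o              ≡⟨ m≥n⇒m⊓n≡n o≤m ⟨
  m ⊓ o          ≤⟨ m≤m+n (m ⊓ o) (n ⊓ o) ⟩
  m ⊓ o + n ⊓ o  ∎
  where open ≤-Reasoning
... | inj₂ m≤o = begin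
  (m + n) ⊓ o        ≤⟨ ⊓-monoʳ-≤ (m + n) (m≤n+m o m) ⟩
  (m + n) ⊓ (m + o)  ≡⟨ +-distribˡ-⊓ m n o ⟨
  m + n ⊓ o          ≡⟨ cong (_+ n ⊓ o) (m≤n⇒m⊓n≡m m≤o) ⟨
  m ⊓ o + n ⊓ o      ∎
  where open ≤-Reasoning

sum⊓≤sum-⊓ : (xs : List A) (f : A → ℕ) (o : ℕ) →
             sum (map f xs) ⊓ o ≤ sum (map (λ x → f x ⊓ o) xs)
sum⊓≤sum-⊓ []       f o = z≤n
sum⊓≤sum-⊓ (x ∷ xs) f o = ≤-trans ([m+n]⊓o≤m⊓o+n⊓o (f x) (sum (map f xs)) o)
                                  (+-monoʳ-≤ (f x ⊓ o) (sum⊓≤sum-⊓ xs f o))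

sum-applyUpTo-+ : ∀ (f : ℕ → ℕ) m n →
  sum (applyUpTo f (m + n)) ≡ sum (applyUpTo f m) + sum (applyUpTo (f ∘ (_+_ m)) n)
sum-applyUpTo-+ f zero    n = refl
sum-applyUpTo-+ f (suc m) n =
  trans (cong (_+_ (f 0)) (sum-applyUpTo-+ (f ∘ suc) m n)) (sym (+-assoc (f 0) _ _))

sum-applyUpTo-cong : ∀ n {f g : ℕ → ℕ} → (∀ k → f k ≡ g k) →
                     sum (applyUpTo f n) ≡ sum (applyUpTo g n)
sum-applyUpTo-cong zero    f≡g = refl
sum-applyUpTo-cong (suc n) f≡g = cong₂ _+_ (f≡g 0) (sum-applyUpTo-cong n (f≡g ∘ suc))

sum-applyUpTo-zero : ∀ n {f : ℕ → ℕ} → (∀ k → f k ≡ 0) → sum (applyUpTo f n) ≡ 0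
sum-applyUpTo-zero zero    f≡0 = refl
sum-applyUpTo-zero (suc n) f≡0 = cong₂ _+_ (f≡0 0) (sum-applyUpTo-zero n (f≡0 ∘ suc))

tabulate-toℕ≡applyUpTo : ∀ n (f : ℕ → A) → tabulate (f ∘ toℕ {n}) ≡ applyUpTo f n
tabulate-toℕ≡applyUpTo zero    f = refl
tabulate-toℕ≡applyUpTo (suc n) f = cong (f 0 ∷_) (tabulate-toℕ≡applyUpTo n (f ∘ suc))

module _ (H : ℕ → ℕ) {N : ℕ} (H-vanishes : ∀ k → N ≤ k → H k ≡ 0) where

  sum-applyUpTo-≤ : ∀ K → sum (applyUpTo H K) ≤ sum (applyUpTo H N)
  sum-applyUpTo-≤ K = begin
    sum (applyUpTo H K)
      ≤⟨ m≤m+n _ _ ⟩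
    sum (applyUpTo H K) + sum (applyUpTo (H ∘ (_+_ K)) N)
      ≡⟨ sum-applyUpTo-+ H K N ⟨
    sum (applyUpTo H (K + N))
      ≡⟨ cong (sum ∘ applyUpTo H) (+-comm K N) ⟩
    sum (applyUpTo H (N + K))
      ≡⟨ sum-applyUpTo-+ H N K ⟩
    sum (applyUpTo H N) + sum (applyUpTo (H ∘ (_+_ N)) K)
      ≡⟨ cong (_+_ _) (sum-applyUpTo-zero K (λ k → H-vanishes (N + k) (m≤m+n N k))) ⟩
    sum (applyUpTo H N) + 0
      ≡⟨ +-identityʳ _ ⟩
    sum (applyUpTo H N)
      ∎
    where open ≤-Reasoning

  sum-applyUpTo-shift-≤ : ∀ e M → sum (applyUpTo (H ∘ (_+_ e)) M) ≤ sum (applyUpTo H N)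
  sum-applyUpTo-shift-≤ e M = begin
    sum (applyUpTo (H ∘ (_+_ e)) M)                       ≤⟨ m≤n+m _ _ ⟩
    sum (applyUpTo H e) + sum (applyUpTo (H ∘ (_+_ e)) M) ≡⟨ sum-applyUpTo-+ H e M ⟨
    sum (applyUpTo H (e + M))                             ≤⟨ sum-applyUpTo-≤ (e + M) ⟩
    sum (applyUpTo H N)                                   ∎
    where open ≤-Reasoning

  module _ (H0≡0 : H 0 ≡ 0) where

    sum-applyUpTo-∸-≤ : ∀ e M → sum (applyUpTo (λ a → H (a ∸ e)) M) ≤ sum (applyUpTo H N)
    sum-applyUpTo-∸-≤ zero    M       = sum-applyUpTo-shift-≤ 0 M
    sum-applyUpTo-∸-≤ (suc e) zero    = z≤n
    sum-applyUpTo-∸-≤ (suc e) (suc M) =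
      subst (_≤ sum (applyUpTo H N)) (cong (_+ sum (applyUpTo (λ a → H (a ∸ e)) M)) (sym H0≡0))
            (sum-applyUpTo-∸-≤ e M)

    sum-applyUpTo-window-≤ : ∀ d c M →
      sum (applyUpTo (λ a → H (d + a ∸ c)) M) ≤ sum (applyUpTo H N)
    sum-applyUpTo-window-≤ d c M with ≤-total c d
    ... | inj₁ c≤d = subst (_≤ _) (sum-applyUpTo-cong M (λ a → cong H (sym (+-∸-comm a c≤d))))
                                  (sum-applyUpTo-shift-≤ (d ∸ c) M)
    ... | inj₂ d≤c = subst (_≤ _) (sum-applyUpTo-cong M (cong H ∘ a∸[c∸d]≡d+a∸c))
                                  (sum-applyUpTo-∸-≤ (c ∸ d) M)
      where
      a∸[c∸d]≡d+a∸c : ∀ a → a ∸ (c ∸ d) ≡ d + a ∸ c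
      a∸[c∸d]≡d+a∸c a = begin
        a ∸ (c ∸ d)            ≡⟨ [m+n]∸[m+o]≡n∸o d a (c ∸ d) ⟨
        d + a ∸ (d + (c ∸ d))  ≡⟨ cong (_∸_ (d + a)) (m+[n∸m]≡n d≤c) ⟩
        d + a ∸ c              ∎
        where open ≡-Reasoning

∣[+m]-[+n]∣≡∣m-n∣ : ∀ m n → ℤ.∣ + m ℤ.- + n ∣ ≡ ∣ m - n ∣
∣[+m]-[+n]∣≡∣m-n∣ m n rewrite ℤ.[+m]-[+n]≡m⊖n m n with ≤-total m n
... | inj₁ m≤n = trans (ℤ.∣⊖∣-≤ m≤n) (sym (m≤n⇒∣m-n∣≡n∸m m≤n))
... | inj₂ n≤m = trans (ℤ.∣m⊖n∣≡∣n⊖m∣ m n) (trans (ℤ.∣⊖∣-≤ n≤m) (sym (m≤n⇒∣n-m∣≡n∸m n≤m)))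

t+m≤n⇒t≤∣[+m]-[+n]∣ : ∀ t m n → t + m ≤ n → t ≤ ℤ.∣ + m ℤ.- + n ∣
t+m≤n⇒t≤∣[+m]-[+n]∣ t m n t+m≤n = begin
  t                      ≤⟨ m+n≤o⇒m≤o∸n t t+m≤n ⟩
  n ∸ m                  ≡⟨ m≤n⇒∣m-n∣≡n∸m (m+n≤o⇒n≤o t t+m≤n) ⟨
  ∣ m - n ∣              ≡⟨ ∣[+m]-[+n]∣≡∣m-n∣ m n ⟨
  ℤ.∣ + m ℤ.- + n ∣      ∎
  where open ≤-Reasoning

[+[t+a∸c]]-[+t]≡[+a]-[+c] : ∀ t a c → c ≤ t + a → + (t + a ∸ c) ℤ.- + t ≡ + a ℤ.- + c
[+[t+a∸c]]-[+t]≡[+a]-[+c] t a c c≤t+a = begin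
  + (t + a ∸ c) ℤ.- + t               ≡⟨ cong (ℤ._- + t) (ℤ.⊖-≥ c≤t+a) ⟨
  (t + a) ℤ.⊖ c ℤ.- + t               ≡⟨ cong (ℤ._- + t) (ℤ.[+m]-[+n]≡m⊖n (t + a) c) ⟨
  + (t + a) ℤ.- + c ℤ.- + t           ≡⟨ cong (λ x → x ℤ.- + c ℤ.- + t) (ℤ.pos-+ t a) ⟩
  (+ t ℤ.+ + a) ℤ.- + c ℤ.- + t       ≡⟨ x+y-z-x≡y-z (+ t) (+ a) (+ c) ⟩
  + a ℤ.- + c                         ∎
  where
  open ≡-Reasoning
  x+y-z-x≡y-z : ∀ x y z → (x ℤ.+ y) ℤ.- z ℤ.- x ≡ y ℤ.- z
  x+y-z-x≡y-z = solve-∀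

-- G (a - c) is rewritten as H (t + a ∸ c) with H k = G (k - t); when the truncation
-- fires, both sides vanish because G is supported in (-t, t).
sum-translate-≤ : ∀ t (G : ℤ → ℕ) → (∀ x → t ≤ ℤ.∣ x ∣ → G x ≡ 0) → ∀ M c →
  sum (map (λ a → G (+ toℕ a ℤ.- + c)) (allFin M)) ≤ sum (map G (intRange t))
sum-translate-≤ t G G-vanishes M c = begin
  sum (map (λ a → G (+ toℕ a ℤ.- + c)) (allFin M))
    ≡⟨ cong sum (trans (map-tabulate id _) (tabulate-toℕ≡applyUpTo M _)) ⟩
  sum (applyUpTo (λ a → G (+ a ℤ.- + c)) M)
    ≡⟨ sum-applyUpTo-cong M G≡H ⟩
  sum (applyUpTo (λ a → H (t + a ∸ c)) M)
    ≤⟨ sum-applyUpTo-window-≤ H H-vanishes H0≡0 t c M ⟩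
  sum (applyUpTo H (suc (t + t)))
    ≡⟨ cong sum (trans (sym (map-∘ (upTo (suc (t + t))))) (map-upTo H (suc (t + t)))) ⟨
  sum (map G (intRange t))
    ∎
  where
  open ≤-Reasoning
  H : ℕ → ℕ
  H k = G (+ k ℤ.- + t)
  H0≡0 : H 0 ≡ 0
  H0≡0 = G-vanishes _ (t+m≤n⇒t≤∣[+m]-[+n]∣ t 0 t (≤-reflexive (+-identityʳ t)))
  H-vanishes : ∀ k → suc (t + t) ≤ k → H k ≡ 0
  H-vanishes k 2t<k = G-vanishes _ (subst (t ≤_) (ℤ.∣i-j∣≡∣j-i∣ (+ t) (+ k))
    (t+m≤n⇒t≤∣[+m]-[+n]∣ t t k (≤-trans (n≤1+n _) 2t<k)))
  G≡H : ∀ a → G (+ a ℤ.- + c) ≡ H (t + a ∸ c)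
  G≡H a with c ≤? t + a
  ... | yes c≤t+a = cong G (sym ([+[t+a∸c]]-[+t]≡[+a]-[+c] t a c c≤t+a))
  ... | no  c≰t+a = begin-equality
    G (+ a ℤ.- + c)  ≡⟨ G-vanishes _ (t+m≤n⇒t≤∣[+m]-[+n]∣ t a c (<⇒≤ (≰⇒> c≰t+a))) ⟩
    0                ≡⟨ H0≡0 ⟨
    H 0              ≡⟨ cong H (m≤n⇒m∸n≡0 (<⇒≤ (≰⇒> c≰t+a))) ⟨
    H (t + a ∸ c)    ∎

displacement : ∀ {n m} → Vertex n m → Vertex n m → Vec ℤ n
displacement {zero}  u v = []
displacement {suc n} u v = (+ toℕ (v Fin.zero) ℤ.- + toℕ (u Fin.zero))
                         ∷ displacement (λ i → u (Fin.suc i)) (λ i → v (Fin.suc i))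

sumFin-suc : ∀ n (h : Fin (suc n) → ℕ) → sumFin (suc n) h ≡ h Fin.zero + sumFin n (h ∘ Fin.suc)
sumFin-suc n h = cong (λ xs → h Fin.zero + sum xs)
  (trans (map-tabulate Fin.suc h) (sym (map-tabulate id (h ∘ Fin.suc))))

normℤ-displacement : ∀ {n m} (u v : Vertex n m) → normℤ (displacement u v) ≡ gridDist u v
normℤ-displacement {zero}  u v = refl
normℤ-displacement {suc n} {m} u v = begin
  ℤ.∣ + toℕ (v Fin.zero) ℤ.- + toℕ (u Fin.zero) ∣ + normℤ (displacement u′ v′)
    ≡⟨ cong (_+ normℤ (displacement u′ v′)) (∣[+m]-[+n]∣≡∣m-n∣ (toℕ (v Fin.zero)) (toℕ (u Fin.zero))) ⟩
  ∣ toℕ (v Fin.zero) - toℕ (u Fin.zero) ∣ + normℤ (displacement u′ v′)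
    ≡⟨ cong₂ _+_ (∣-∣-comm (toℕ (v Fin.zero)) (toℕ (u Fin.zero))) (normℤ-displacement u′ v′) ⟩
  ∣ toℕ (u Fin.zero) - toℕ (v Fin.zero) ∣ + gridDist u′ v′
    ≡⟨ sumFin-suc n (λ i → ∣ toℕ (u i) - toℕ (v i) ∣) ⟨
  gridDist u v ∎
  where
  open ≡-Reasoning
  u′ v′ : Vertex n (m ∘ Fin.suc)
  u′ i = u (Fin.suc i)
  v′ i = v (Fin.suc i)

sum-displacement≤sum-boxPoints : ∀ t n {m} (u : Vertex n m) (F : Vec ℤ n → ℕ) →
  (∀ p → t ≤ normℤ p → F p ≡ 0) →
  sum (map (F ∘ displacement u) (allVertices n m)) ≤ sum (map F (boxPoints n t))
sum-displacement≤sum-boxPoints t zero    u F F-vanishes = ≤-refl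
sum-displacement≤sum-boxPoints t (suc n) {m} u F F-vanishes = begin
  sum (map (F ∘ displacement u) (allVertices (suc n) m))
    ≡⟨ sum-map-concatMap-map (allFin (m Fin.zero)) W consV (F ∘ displacement u) ⟩
  sum (map (λ a → sum (map (λ w → F (offset a ∷ displacement u′ w)) W)) (allFin (m Fin.zero)))
    ≤⟨ sum-map-mono-≤ (allFin (m Fin.zero)) (λ a →
         sum-displacement≤sum-boxPoints t n u′ (F ∘ (offset a ∷_))
           (λ p t≤∣p∣ → F-vanishes _ (≤-trans t≤∣p∣ (m≤n+m _ _)))) ⟩
  sum (map (λ a → G (offset a)) (allFin (m Fin.zero)))
    ≤⟨ sum-translate-≤ t G G-vanishes (m Fin.zero) (toℕ (u Fin.zero)) ⟩
  sum (map G (intRange t))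
    ≡⟨ sum-map-concatMap-map (intRange t) (boxPoints n t) _∷_ F ⟨
  sum (map F (boxPoints (suc n) t)) ∎
  where
  open ≤-Reasoning
  u′ : Vertex n (m ∘ Fin.suc)
  u′ i = u (Fin.suc i)
  W : List (Vertex n (m ∘ Fin.suc))
  W = allVertices n (m ∘ Fin.suc)
  offset : Fin (m Fin.zero) → ℤ
  offset a = + toℕ a ℤ.- + toℕ (u Fin.zero)
  G : ℤ → ℕ
  G x = sum (map (F ∘ (x ∷_)) (boxPoints n t))
  G-vanishes : ∀ x → t ≤ ℤ.∣ x ∣ → G x ≡ 0
  G-vanishes x t≤∣x∣ = sum-map-zero (boxPoints n t) (λ p → F-vanishes _ (≤-trans t≤∣x∣ (m≤m+n _ _)))

sum-unwasted≤C : ∀ t r n {m} (u : Vertex n m) →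
  sum (map (λ v → (t ∸ gridDist u v) ⊓ r) (allVertices n m)) ≤ C t r n
sum-unwasted≤C t r n {m} u = subst (_≤ C t r n)
  (cong sum (map-cong (λ v → cong (λ d → (t ∸ d) ⊓ r) (normℤ-displacement u v)) (allVertices n m)))
  (sum-displacement≤sum-boxPoints t n u (λ p → (t ∸ normℤ p) ⊓ r)
    (λ p t≤∣p∣ → cong (_⊓ r) (m≤n⇒m∸n≡0 t≤∣p∣)))

theorem11 : (t r n : ℕ) → 1 ≤ r → r ≤ t → 1 ≤ n →
    (m : Fin n → ℕ) → ((i : Fin n) → 1 ≤ m i) →
    (D : Vertex n m → Bool) → IsBroadcastDominating t r D →
    r * length (allVertices n m) ≤ card D * C t r n
theorem11 t r n _ _ _ m _ D dominating = begin
  r * length V                                   ≡⟨ *-comm r (length V) ⟩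
  length V * r                                   ≡⟨ sum-map-const V r ⟨
  sum (map (λ _ → r) V)                          ≤⟨ sum-map-mono-≤ V capped-reception ⟩
  sum (map (λ v → sum (map (λ u → K u v) Dl)) V) ≡⟨ sum-map-swap Dl V K ⟨
  sum (map (λ u → sum (map (K u) V)) Dl)         ≤⟨ sum-map-mono-≤ Dl (sum-unwasted≤C t r n) ⟩
  sum (map (λ _ → C t r n) Dl)                   ≡⟨ sum-map-const Dl (C t r n) ⟩
  card D * C t r n                               ∎
  where
  open ≤-Reasoning
  V Dl : List (Vertex n m)
  V  = allVertices n m
  Dl = filter (λ u → D u Bool.≟ true) V
  K : Vertex n m → Vertex n m → ℕ
  K u v = (t ∸ gridDist u v) ⊓ r
  capped-reception : ∀ v → r ≤ sum (map (λ u → K u v) Dl)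
  capped-reception v = begin
    r                           ≡⟨ m≥n⇒m⊓n≡n (dominating v) ⟨
    reception t D v ⊓ r         ≤⟨ sum⊓≤sum-⊓ Dl (λ u → t ∸ gridDist u v) r ⟩
    sum (map (λ u → K u v) Dl)  ∎
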